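{- $\mathsf{IPHT}^2_2$ with apartness is strongly computably reducible to $\mathsf{HT}^{!\omega}_2$ with apartness.
   Context: $\mathbb{N}$ denotes the positive integers. For $m\in\mathbb{N}$, $\lambda(m)$ and $\mu(m)$ are the least and greatest exponents in the binary expansion of $m$; $X\subseteq\mathbb{N}$ is apart if for all $x<x'$ in $X$, $\mu(x)<\lambda(x')$. A finite set $S\subseteq\mathbb{N}$ is exactly large if $|S|=\min(S)+1$; $\mathrm{FS}^{!\omega}(H)$ is the set of numbers $\sum S$ with $S$ an exactly large subset of $H$. $\mathsf{HT}^{!\omega}_2$ with apartness: for every $f:\mathbb{N}\to 2$ there is an infinite apart $H\subseteq\mathbb{N}$ such that $\mathrm{FS}^{!\omega}(H)$ is monochromatic for $f$. $\mathsf{IPHT}^2_2$ with apartness: for every $f:\mathbb{N}\to 2$ there are infinite $H_1,H_2\subseteq\mathbb{N}$ with $H_1\cup H_2$ apart and a colour $k<2$ such that $f(x_1+x_2)=k$ for all $x_1\in H_1$, $x_2\in H_2$ with $x_1<x_2$. $\mathsf{Q}$ is strongly computably reducible to $\mathsf{P}$ if for every instance $I$ of $\mathsf{Q}$ there is an instance $J$ of $\mathsf{P}$ computable from $I$ such that every solution of $J$ computes a solution of $I$. -}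

module Defs where

open import Data.Nat using (ℕ; zero; suc; _+_; _*_; _^_; _≤_; _<_)
open import Data.Nat.Divisibility using (_∣_)
open import Data.Bool using (Bool; true; false; _∨_; if_then_else_)
open import Data.Fin using (Fin)
open import Data.Vec using (Vec; []; _∷_; lookup)
open import Data.List using (List; []; _∷_; length)
open import Data.Nat.ListAction using (sum)
open import Data.List.Relation.Unary.All using (All)
open import Data.List.Relation.Unary.Linked using (Linked)
open import Data.Product using (Σ; ∃; _×_; _,_)
open import Relation.Nullary using (¬_)
open import Relation.Binary.PropositionalEquality using (_≡_)

-- Sets of naturals are given by characteristic functions ℕ → Bool.
-- The paper's ℕ is the positive integers; we use Agda's ℕ and require
-- solution sets to avoid 0 explicitly.

Set⊆ℕ : Set
Set⊆ℕ = ℕ → Bool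

_∈_ : ℕ → Set⊆ℕ → Set
x ∈ X = X x ≡ true

Positive : Set⊆ℕ → Set
Positive X = X 0 ≡ false

Infinite : Set⊆ℕ → Set
Infinite X = ∀ n → ∃ λ m → n < m × m ∈ X

_∪_ : Set⊆ℕ → Set⊆ℕ → Set⊆ℕ
(X ∪ Y) n = X n ∨ Y n

-- λ(m) and μ(m): least / greatest exponent in the binary expansion of m.

IsLeastExp : ℕ → ℕ → Set
IsLeastExp m i = (2 ^ i ∣ m) × ¬ (2 ^ suc i ∣ m)

IsGreatestExp : ℕ → ℕ → Set
IsGreatestExp m i = (2 ^ i ≤ m) × (m < 2 ^ suc i)

Apart : Set⊆ℕ → Set
Apart X = ∀ x x' → x ∈ X → x' ∈ X → x < x' →
          ∀ i j → IsGreatestExp x i → IsLeastExp x' j → i < j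

ExactlyLargeSubset : List ℕ → Set⊆ℕ → Set
ExactlyLargeSubset [] H = Data.Empty.⊥
  where import Data.Empty
ExactlyLargeSubset (s ∷ rest) H =
  Linked _<_ (s ∷ rest) × All (λ x → x ∈ H) (s ∷ rest) × length (s ∷ rest) ≡ s + 1

InFSω : ℕ → Set⊆ℕ → Set
InFSω n H = ∃ λ S → ExactlyLargeSubset S H × sum S ≡ n

-- Instances / solutions (colourings f : ℕ → 2 with 2 = Bool;
-- the value at 0 is irrelevant).

HTSol : (ℕ → Bool) → Set⊆ℕ → Set
HTSol J H = Positive H × Infinite H × Apart H ×
            ∃ λ (k : Bool) → ∀ n → InFSω n H → J n ≡ k

IPHTSol : (ℕ → Bool) → Set⊆ℕ → Set⊆ℕ → Set
IPHTSol f H₁ H₂ = Positive H₁ × Positive H₂ × Infinite H₁ × Infinite H₂ ×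
                  Apart (H₁ ∪ H₂) ×
                  ∃ λ (k : Bool) → ∀ x₁ x₂ → x₁ ∈ H₁ → x₂ ∈ H₂ → x₁ < x₂ →
                                    f (x₁ + x₂) ≡ k

data PR : ℕ → Set where
  zer  : ∀ {n} → PR n
  succ : PR 1
  proj : ∀ {n} → Fin n → PR n
  orc  : PR 1
  comp : ∀ {n m} → PR m → Vec (PR n) m → PR n
  prec : ∀ {n} → PR n → PR (suc (suc n)) → PR (suc n)
  mu   : ∀ {n} → PR (suc n) → PR n

mutual
  data Eval (α : ℕ → ℕ) : ∀ {n} → PR n → Vec ℕ n → ℕ → Set where
    e-zer  : ∀ {n} {xs : Vec ℕ n} → Eval α zer xs 0
    e-succ : ∀ {x} → Eval α succ (x ∷ []) (suc x)
    e-proj : ∀ {n} {i : Fin n} {xs} → Eval α (proj i) xs (lookup xs i)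
    e-orc  : ∀ {x} → Eval α orc (x ∷ []) (α x)
    e-comp : ∀ {n m} {g : PR m} {hs : Vec (PR n) m} {xs ys y} →
             EvalVec α hs xs ys → Eval α g ys y → Eval α (comp g hs) xs y
    e-prec0 : ∀ {n} {g : PR n} {h} {xs y} →
              Eval α g xs y → Eval α (prec g h) (0 ∷ xs) y
    e-precS : ∀ {n} {g : PR n} {h} {xs t r y} →
              Eval α (prec g h) (t ∷ xs) r →
              Eval α h (t ∷ r ∷ xs) y → Eval α (prec g h) (suc t ∷ xs) y
    e-mu   : ∀ {n} {g : PR (suc n)} {xs y} →
             Eval α g (y ∷ xs) 0 →
             (∀ z → z < y → Σ ℕ λ v → Eval α g (z ∷ xs) (suc v)) →
             Eval α (mu g) xs y

  data EvalVec (α : ℕ → ℕ) {n : ℕ} : ∀ {m} → Vec (PR n) m → Vec ℕ n → Vec ℕ m → Set where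
    ev-[] : ∀ {xs} → EvalVec α [] xs []
    ev-∷  : ∀ {m} {h : PR n} {hs : Vec (PR n) m} {xs y ys} →
            Eval α h xs y → EvalVec α hs xs ys → EvalVec α (h ∷ hs) xs (y ∷ ys)

Computes : (ℕ → ℕ) → (ℕ → ℕ) → Set
Computes α g = ∃ λ (c : PR 1) → ∀ x → Eval α c (x ∷ []) (g x)

χ : Bool → ℕ
χ b = if b then 1 else 0

⌜_⌝ : (ℕ → Bool) → ℕ → ℕ
⌜ X ⌝ n = χ (X n)

-- The reduction is the identity on colourings. Cut an apart H with monochromatic FS^{!ω}(H) into
-- consecutive blocks: a block opened by a ∈ H consists of a, the next a ∸ 1 elements of H and one
-- closing element. Let H₁ collect the sums of the first a elements of the blocks and H₂ the closing
-- elements; a primitive recursive scan of H computes both. If x₁ ∈ H₁ is below x₂ ∈ H₂, the a summands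
-- of x₁ together with x₂ form an exactly large subset of H, so f (x₁ + x₂) is the colour of FS^{!ω}(H).
-- H₁ ∪ H₂ inherits apartness: in an apart set a sum of elements below c is below 2 ^ λ(c), while a sum
-- of elements from c on is divisible by 2 ^ λ(c).
module Submission where

open import Defs
open import Data.Nat
  using (ℕ; zero; suc; _+_; _*_; _∸_; _^_; _≤_; _<_; z≤n; s≤s; s≤s⁻¹; _≡ᵇ_; pred; >-nonZero)
open import Data.Nat.Properties
open import Data.Bool using (Bool; true; false; _∧_; if_then_else_; T)
open import Data.Unit using (tt)
open import Data.Fin using (Fin; zero; suc)
open import Data.Vec using (Vec; []; _∷_; lookup)
open import Data.List using (List; []; _∷_; _++_; length)
open import Data.Nat.ListAction using (sum)
open import Data.Nat.ListAction.Properties using (sum-++)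
open import Data.List.Properties using (length-++)
open import Data.Nat.Divisibility using (_∣_; divides; _∣?_; ∣-trans; ∣⇒≤; m∣m*n; ∣m∣n⇒∣m+n; _∣0)
open import Data.List.Relation.Unary.All using (All; []; _∷_)
import Data.List.Relation.Unary.All.Properties as All
open import Data.List.Relation.Unary.Linked using (Linked; [-]; _∷_)
open import Data.Sum using (_⊎_; inj₁; inj₂)
open import Data.Empty using (⊥-elim)
open import Relation.Nullary using (¬_; yes; no)
open import Data.Product using (Σ; ∃; _×_; _,_; proj₁; proj₂)
open import Relation.Binary.PropositionalEquality using (_≡_; refl; sym; trans; cong; cong₂; subst; module ≡-Reasoning)
open import Function using (case_of_)
open import Relation.Binary.Definitions using (tri<; tri≈; tri>)

≡ᵇ-true⇒≡ : ∀ {m n} → (m ≡ᵇ n) ≡ true → m ≡ n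
≡ᵇ-true⇒≡ {m} {n} e = ≡ᵇ⇒≡ m n (subst T (sym e) tt)

≡ᵇ-refl : ∀ n → (n ≡ᵇ n) ≡ true
≡ᵇ-refl zero    = refl
≡ᵇ-refl (suc n) = ≡ᵇ-refl n

isZero : ℕ → ℕ
isZero zero    = 1
isZero (suc _) = 0

ifNonZero : ℕ → ℕ → ℕ → ℕ
ifNonZero zero    a b = b
ifNonZero (suc _) a b = a

module OracleComputable (α : ℕ → ℕ) where

  Computable : (n : ℕ) → (Vec ℕ n → ℕ) → Set
  Computable n F = Σ (PR n) λ c → ∀ xs → Eval α c xs (F xs)

  computable-ext : ∀ {n} {F G : Vec ℕ n → ℕ} → (∀ xs → F xs ≡ G xs) → Computable n F → Computable n G
  computable-ext F≗G (c , eval) = c , λ xs → subst (Eval α c xs) (F≗G xs) (eval xs)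

  computable⇒computes : ∀ {g} → Computable 1 (λ { (x ∷ []) → g x }) → Computes α g
  computable⇒computes (c , eval) = c , λ x → eval (x ∷ [])

  const₀ : ∀ {n} → Computable n (λ _ → 0)
  const₀ = zer , λ _ → e-zer

  successor : Computable 1 (λ { (x ∷ []) → suc x })
  successor = succ , λ { (x ∷ []) → e-succ }

  projection : ∀ {n} (i : Fin n) → Computable n (λ xs → lookup xs i)
  projection i = proj i , λ _ → e-proj

  oracle : Computable 1 (λ { (x ∷ []) → α x })
  oracle = orc , λ { (x ∷ []) → e-orc }

  compose₁ : ∀ {n G F₁} → Computable 1 G → Computable n F₁ →
             Computable n (λ xs → G (F₁ xs ∷ []))
  compose₁ (g , eg) (h₁ , e₁) = comp g (h₁ ∷ []) , λ xs → e-comp (ev-∷ (e₁ xs) ev-[]) (eg _)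

  compose₂ : ∀ {n G F₁ F₂} → Computable 2 G → Computable n F₁ → Computable n F₂ →
             Computable n (λ xs → G (F₁ xs ∷ F₂ xs ∷ []))
  compose₂ (g , eg) (h₁ , e₁) (h₂ , e₂) =
    comp g (h₁ ∷ h₂ ∷ []) , λ xs → e-comp (ev-∷ (e₁ xs) (ev-∷ (e₂ xs) ev-[])) (eg _)

  compose₃ : ∀ {n G F₁ F₂ F₃} → Computable 3 G →
             Computable n F₁ → Computable n F₂ → Computable n F₃ →
             Computable n (λ xs → G (F₁ xs ∷ F₂ xs ∷ F₃ xs ∷ []))
  compose₃ (g , eg) (h₁ , e₁) (h₂ , e₂) (h₃ , e₃) =
    comp g (h₁ ∷ h₂ ∷ h₃ ∷ []) ,
    λ xs → e-comp (ev-∷ (e₁ xs) (ev-∷ (e₂ xs) (ev-∷ (e₃ xs) ev-[]))) (eg _)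

  primRec : ∀ {n G S} → Computable n G → Computable (suc (suc n)) S → (F : Vec ℕ (suc n) → ℕ) →
            (∀ xs → F (0 ∷ xs) ≡ G xs) →
            (∀ t xs → F (suc t ∷ xs) ≡ S (t ∷ F (t ∷ xs) ∷ xs)) → Computable (suc n) F
  primRec (g , eg) (h , eh) F F-zero F-suc = prec g h , eval
    where
    eval : ∀ xs → Eval α (prec g h) xs (F xs)
    eval (zero ∷ xs)  = e-prec0 (subst (Eval α g xs) (sym (F-zero xs)) (eg xs))
    eval (suc t ∷ xs) = e-precS (eval (t ∷ xs)) (subst (Eval α h _) (sym (F-suc t xs)) (eh _))

  const₁ : ∀ {n} → Computable n (λ _ → 1)
  const₁ = compose₁ successor const₀

  isZero-computable : Computable 1 (λ { (x ∷ []) → isZero x })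
  isZero-computable = primRec const₁ const₀ _ (λ { [] → refl }) (λ { t [] → refl })

  pred-computable : Computable 1 (λ { (x ∷ []) → pred x })
  pred-computable = primRec const₀ (projection zero) _ (λ { [] → refl }) (λ { t [] → refl })

  +-computable : Computable 2 (λ { (x ∷ y ∷ []) → x + y })
  +-computable = primRec (projection zero) (compose₁ successor (projection (suc zero))) _
                   (λ { (y ∷ []) → refl }) (λ { t (y ∷ []) → refl })

  ∸-computable : Computable 2 (λ { (m ∷ n ∷ []) → m ∸ n })
  ∸-computable = computable-ext (λ { (m ∷ n ∷ []) → refl })
                   (compose₂ flipped (projection (suc zero)) (projection zero))
    where
    flipped : Computable 2 (λ { (n ∷ m ∷ []) → m ∸ n })
    flipped = primRec (projection zero) (compose₁ pred-computable (projection (suc zero))) _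
                (λ { (m ∷ []) → refl }) (λ { t (m ∷ []) → sym (pred[m∸n]≡m∸[1+n] m t) })

  ifNonZero-computable : Computable 3 (λ { (c ∷ a ∷ b ∷ []) → ifNonZero c a b })
  ifNonZero-computable = primRec (projection (suc zero)) (projection (suc (suc zero))) _
                           (λ { (a ∷ b ∷ []) → refl }) (λ { t (a ∷ b ∷ []) → refl })

  isZero-distance : ∀ a b → isZero ((a ∸ b) + (b ∸ a)) ≡ χ (a ≡ᵇ b)
  isZero-distance zero    zero    = refl
  isZero-distance zero    (suc b) = refl
  isZero-distance (suc a) zero    = refl
  isZero-distance (suc a) (suc b) = isZero-distance a b

  ≡ᵇ-computable : Computable 2 (λ { (a ∷ b ∷ []) → χ (a ≡ᵇ b) })
  ≡ᵇ-computable =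
    computable-ext (λ { (a ∷ b ∷ []) → isZero-distance a b })
      (compose₁ isZero-computable
        (compose₂ +-computable ∸-computable
          (compose₂ ∸-computable (projection (suc zero)) (projection zero))))

module BinaryExponents where

  open ≤-Reasoning

  2^-∣-mono : ∀ {a b} → a ≤ b → 2 ^ a ∣ 2 ^ b
  2^-∣-mono {a} a≤b = subst (λ t → 2 ^ a ∣ 2 ^ t) (m+[n∸m]≡n a≤b)
    (subst (2 ^ a ∣_) (sym (^-distribˡ-+-* 2 a _)) (m∣m*n _))

  2^-cancel-< : ∀ {a b} → 2 ^ a < 2 ^ b → a < b
  2^-cancel-< {a} {b} 2^a<2^b with a <? b
  ... | yes a<b = a<b
  ... | no  a≮b = ⊥-elim (<⇒≱ 2^a<2^b (^-monoʳ-≤ 2 (≮⇒≥ a≮b)))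

  n<2^n : ∀ n → n < 2 ^ n
  n<2^n zero    = s≤s z≤n
  n<2^n (suc n) = begin-strict
    suc n           ≤⟨ n<2^n n ⟩
    2 ^ n           <⟨ m<m+n (2 ^ n) (m^n>0 2 n) ⟩
    2 ^ n + 2 ^ n   ≡⟨ cong (2 ^ n +_) (sym (+-identityʳ _)) ⟩
    2 ^ suc n       ∎

  -- Both searches run upwards from exponent 0 with fuel m, enough since m < 2 ^ m.
  ∃IsLeastExp : ∀ m → 0 < m → ∃ (IsLeastExp m)
  ∃IsLeastExp m@(suc _) _ = search m 0 (divides m (sym (*-identityʳ m))) (λ d → <⇒≱ (n<2^n m) (∣⇒≤ d))
    where
    search : ∀ fuel k → 2 ^ k ∣ m → ¬ (2 ^ (k + fuel) ∣ m) → ∃ (IsLeastExp m)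
    search zero k 2^k∣m 2^k∤m = ⊥-elim (2^k∤m (subst (λ t → 2 ^ t ∣ m) (sym (+-identityʳ k)) 2^k∣m))
    search (suc fuel) k 2^k∣m 2^k+fuel∤m with 2 ^ suc k ∣? m
    ... | yes 2^k+1∣m = search fuel (suc k) 2^k+1∣m (subst (λ t → ¬ (2 ^ t ∣ m)) (+-suc k fuel) 2^k+fuel∤m)
    ... | no  2^k+1∤m = k , 2^k∣m , 2^k+1∤m

  ∃IsGreatestExp : ∀ m → 0 < m → ∃ (IsGreatestExp m)
  ∃IsGreatestExp m@(suc _) _ = search m 0 (s≤s z≤n) (n<2^n m)
    where
    search : ∀ fuel k → 2 ^ k ≤ m → m < 2 ^ (k + fuel) → ∃ (IsGreatestExp m)
    search zero k 2^k≤m m<2^k = ⊥-elim (<⇒≱ m<2^k (subst (λ t → 2 ^ t ≤ m) (sym (+-identityʳ k)) 2^k≤m))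
    search (suc fuel) k 2^k≤m m<2^k+fuel with 2 ^ suc k ≤? m
    ... | yes 2^k+1≤m = search fuel (suc k) 2^k+1≤m (subst (λ t → m < 2 ^ t) (+-suc k fuel) m<2^k+fuel)
    ... | no  2^k+1≰m = k , 2^k≤m , ≰⇒> 2^k+1≰m

  leastExp≤greatestExp : ∀ {m i j} → 0 < m → IsLeastExp m j → IsGreatestExp m i → j ≤ i
  leastExp≤greatestExp {suc _} _ (2^j∣m , _) (_ , m<2^i+1) =
    s≤s⁻¹ (2^-cancel-< (≤-<-trans (∣⇒≤ 2^j∣m) m<2^i+1))

  2^∣⇒≤leastExp : ∀ {m e j} → 2 ^ e ∣ m → IsLeastExp m j → e ≤ j
  2^∣⇒≤leastExp {e = e} {j} 2^e∣m (_ , 2^j+1∤m) with e ≤? j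
  ... | yes e≤j = e≤j
  ... | no  e≰j = ⊥-elim (2^j+1∤m (∣-trans (2^-∣-mono (≰⇒> e≰j)) 2^e∣m))

  multiples-gap : ∀ {d m n} → d ∣ m → d ∣ n → m < n → m + d ≤ n
  multiples-gap {d} (divides a refl) (divides b refl) a*d<b*d =
    subst (_≤ b * d) (+-comm d (a * d)) (*-monoˡ-≤ d (*-cancelʳ-< d a b a*d<b*d))

module Window (H : Set⊆ℕ) where

  window : ℕ → ℕ → List ℕ
  window lo zero    = []
  window lo (suc n) = if H lo then lo ∷ window (suc lo) n else window (suc lo) n

  window-cons : ∀ {lo} n → lo ∈ H → window lo (suc n) ≡ lo ∷ window (suc lo) n
  window-cons n lo∈H rewrite lo∈H = refl

  window-snoc-∈ : ∀ n lo {y} → lo + n ≡ y → y ∈ H → window lo (suc n) ≡ window lo n ++ y ∷ []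
  window-snoc-∈ zero lo lo+0≡y y∈H with refl ← trans (sym (+-identityʳ lo)) lo+0≡y rewrite y∈H = refl
  window-snoc-∈ (suc n) lo lo+n≡y y∈H with H lo
  ... | true  = cong (lo ∷_) (window-snoc-∈ n (suc lo) (trans (sym (+-suc lo n)) lo+n≡y) y∈H)
  ... | false = window-snoc-∈ n (suc lo) (trans (sym (+-suc lo n)) lo+n≡y) y∈H

  window-snoc-∉ : ∀ n lo {y} → lo + n ≡ y → H y ≡ false → window lo (suc n) ≡ window lo n
  window-snoc-∉ zero lo lo+0≡y y∉H with refl ← trans (sym (+-identityʳ lo)) lo+0≡y rewrite y∉H = refl
  window-snoc-∉ (suc n) lo lo+n≡y y∉H with H lo
  ... | true  = cong (lo ∷_) (window-snoc-∉ n (suc lo) (trans (sym (+-suc lo n)) lo+n≡y) y∉H)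
  ... | false = window-snoc-∉ n (suc lo) (trans (sym (+-suc lo n)) lo+n≡y) y∉H

  window⊆H : ∀ n lo → All (_∈ H) (window lo n)
  window⊆H zero    lo = []
  window⊆H (suc n) lo with H lo in lo∈H
  ... | true  = lo∈H ∷ window⊆H n (suc lo)
  ... | false = window⊆H n (suc lo)

  window-linked : ∀ n {x lo z} → x < lo → lo + n ≤ z → Linked _<_ (x ∷ window lo n ++ z ∷ [])
  window-linked zero    {lo = lo} x<lo lo+0≤z = <-≤-trans x<lo (subst (_≤ _) (+-identityʳ lo) lo+0≤z) ∷ [-]
  window-linked (suc n) {lo = lo} {z} x<lo lo+n≤z with H lo
  ... | true  = x<lo ∷ window-linked n ≤-refl (subst (_≤ z) (+-suc lo n) lo+n≤z)
  ... | false = window-linked n (m<n⇒m<1+n x<lo) (subst (_≤ z) (+-suc lo n) lo+n≤z)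

  ≤-sum-window : ∀ n {lo h} → h ∈ H → lo ≤ h → h < lo + n → h ≤ sum (window lo n)
  ≤-sum-window zero    {lo} h∈H lo≤h h<lo+0 = ⊥-elim (<⇒≱ h<lo+0 (subst (_≤ _) (sym (+-identityʳ lo)) lo≤h))
  ≤-sum-window (suc n) {lo} {h} h∈H lo≤h h<lo+n with H lo in e | m≤n⇒m<n∨m≡n lo≤h
  ... | true  | inj₂ refl = m≤m+n lo _
  ... | true  | inj₁ lo<h = ≤-trans (≤-sum-window n h∈H lo<h (subst (h <_) (+-suc lo n) h<lo+n)) (m≤n+m _ lo)
  ... | false | inj₂ refl with () ← trans (sym e) h∈H
  ... | false | inj₁ lo<h = ≤-sum-window n h∈H lo<h (subst (h <_) (+-suc lo n) h<lo+n)

  length-window≡⇒sum-window≡ : ∀ {m n} lo → m ≤ n → length (window lo m) ≡ length (window lo n) →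
                               sum (window lo m) ≡ sum (window lo n)
  length-window≡⇒sum-window≡ {zero} {n} lo _ len≡ with window lo n
  ... | [] = refl
  length-window≡⇒sum-window≡ {suc m} {suc n} lo (s≤s m≤n) len≡ with H lo
  ... | true  = cong (lo +_) (length-window≡⇒sum-window≡ (suc lo) m≤n (suc-injective len≡))
  ... | false = length-window≡⇒sum-window≡ (suc lo) m≤n len≡

  ∣-sum-window : ∀ {d} n lo → (∀ h → h ∈ H → lo ≤ h → d ∣ h) → d ∣ sum (window lo n)
  ∣-sum-window zero    lo d∣H = _ ∣0
  ∣-sum-window (suc n) lo d∣H with H lo in lo∈H
  ... | true  = ∣m∣n⇒∣m+n (d∣H lo lo∈H ≤-refl)
                  (∣-sum-window n (suc lo) (λ h h∈H lo<h → d∣H h h∈H (<⇒≤ lo<h)))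
  ... | false = ∣-sum-window n (suc lo) (λ h h∈H lo<h → d∣H h h∈H (<⇒≤ lo<h))

module ApartWindowSums (H : Set⊆ℕ) (H-positive : Positive H) (H-apart : Apart H) where

  open BinaryExponents
  open Window H

  ∈⇒>0 : ∀ {h} → h ∈ H → 0 < h
  ∈⇒>0 {zero}  0∈H with () ← trans (sym H-positive) 0∈H
  ∈⇒>0 {suc h} _   = s≤s z≤n

  2^[1+greatestExp]∣later : ∀ {g h i} → g ∈ H → h ∈ H → g < h → IsGreatestExp g i → 2 ^ suc i ∣ h
  2^[1+greatestExp]∣later {g} {h} {i} g∈H h∈H g<h μg with ∃IsLeastExp h (∈⇒>0 h∈H)
  ... | j , λh = ∣-trans (2^-∣-mono (H-apart g h g∈H h∈H g<h i j μg λh)) (proj₁ λh)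

  2^leastExp∣sum-window : ∀ {lo j} n → lo ∈ H → IsLeastExp lo j → 2 ^ j ∣ sum (window lo n)
  2^leastExp∣sum-window {lo} {j} n lo∈H λlo = ∣-sum-window n lo 2^j∣
    where
    2^j∣ : ∀ h → h ∈ H → lo ≤ h → 2 ^ j ∣ h
    2^j∣ h h∈H lo≤h with m≤n⇒m<n∨m≡n lo≤h
    ... | inj₂ refl = proj₁ λlo
    ... | inj₁ lo<h with ∃IsGreatestExp lo (∈⇒>0 lo∈H)
    ... | i , μlo = ∣-trans (2^-∣-mono {j} {suc i} (m≤n⇒m≤1+n (leastExp≤greatestExp (∈⇒>0 lo∈H) λlo μlo)))
                            (2^[1+greatestExp]∣later {i = i} lo∈H h∈H lo<h μlo)

  -- Each element lo is below 2 ^ (1 + μ lo), which divides both the rest of the window and 2 ^ λ c.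
  sum-window<2^leastExp : ∀ {c j} n lo → c ∈ H → lo + n ≤ c → IsLeastExp c j → sum (window lo n) < 2 ^ j
  sum-window<2^leastExp {j = j} zero lo _ _ _ = m^n>0 2 j
  sum-window<2^leastExp {c} {j} (suc n) lo c∈H lo+n≤c λc with H lo in lo∈H
  ... | false = sum-window<2^leastExp {c} {j} n (suc lo) c∈H (subst (_≤ c) (+-suc lo n) lo+n≤c) λc
  ... | true with ∃IsGreatestExp lo (∈⇒>0 lo∈H)
  ... | i , μlo@(_ , lo<2^i+1) = begin-strict
    lo + rest          <⟨ +-monoˡ-< rest lo<2^i+1 ⟩
    2 ^ suc i + rest   ≡⟨ +-comm (2 ^ suc i) rest ⟩
    rest + 2 ^ suc i   ≤⟨ multiples-gap 2^i+1∣rest 2^i+1∣2^j rest<2^j ⟩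
    2 ^ j              ∎
    where
    open ≤-Reasoning
    rest : ℕ
    rest = sum (window (suc lo) n)
    suc-lo+n≤c : suc lo + n ≤ c
    suc-lo+n≤c = subst (_≤ c) (+-suc lo n) lo+n≤c
    rest<2^j : rest < 2 ^ j
    rest<2^j = sum-window<2^leastExp {c} {j} n (suc lo) c∈H suc-lo+n≤c λc
    2^i+1∣rest : 2 ^ suc i ∣ rest
    2^i+1∣rest = ∣-sum-window n (suc lo) (λ h h∈H lo<h → 2^[1+greatestExp]∣later {i = i} lo∈H h∈H lo<h μlo)
    2^i+1∣2^j : 2 ^ suc i ∣ 2 ^ j
    2^i+1∣2^j = 2^-∣-mono {suc i} {j} (2^∣⇒≤leastExp (2^[1+greatestExp]∣later {i = i} lo∈H c∈H lo<c μlo) λc)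
      where
      lo<c : lo < c
      lo<c = ≤-trans (s≤s (m≤m+n lo n)) suc-lo+n≤c

-- state y counts the elements the current block still awaits after reading H below y (0 between
-- blocks); partialSum y is the sum of the elements of the block read so far, without the closing one.
module BlockScan (H : Set⊆ℕ) where

  nextState : ℕ → ℕ → ℕ
  nextState zero    y = y
  nextState (suc s) y = s

  nextSum : ℕ → ℕ → ℕ → ℕ
  nextSum zero    p y = y
  nextSum (suc s) p y = ifNonZero s (p + y) p

  state : ℕ → ℕ
  state zero    = 0
  state (suc y) = if H y then nextState (state y) y else state y

  partialSum : ℕ → ℕ
  partialSum zero    = 0
  partialSum (suc y) = if H y then nextSum (state y) (partialSum y) y else partialSum y

  -- The sum x of the first a elements of a block lies below the closing element, so the scan at x + 1
  -- already knows it.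
  H₁ : Set⊆ℕ
  H₁ x = (state (suc x) ≡ᵇ 1) ∧ (partialSum (suc x) ≡ᵇ x)

  H₂ : Set⊆ℕ
  H₂ x = H x ∧ (state x ≡ᵇ 1)

  H₁-positive : Positive H → Positive H₁
  H₁-positive 0∉H rewrite 0∉H = refl

  H₂-positive : Positive H → Positive H₂
  H₂-positive 0∉H rewrite 0∉H = refl

  state-∉ : ∀ {y} → H y ≡ false → state (suc y) ≡ state y
  state-∉ y∉H rewrite y∉H = refl

  partialSum-∉ : ∀ {y} → H y ≡ false → partialSum (suc y) ≡ partialSum y
  partialSum-∉ y∉H rewrite y∉H = refl

  state-∈ : ∀ {y} → y ∈ H → state (suc y) ≡ nextState (state y) y
  state-∈ y∈H rewrite y∈H = refl

  partialSum-∈ : ∀ {y} → y ∈ H → partialSum (suc y) ≡ nextSum (state y) (partialSum y) y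
  partialSum-∈ y∈H rewrite y∈H = refl

  open OracleComputable ⌜ H ⌝

  if⇒ifNonZero : ∀ b (x y : ℕ) → (if b then x else y) ≡ ifNonZero (χ b) x y
  if⇒ifNonZero true  x y = refl
  if⇒ifNonZero false x y = refl

  χ-∧ : ∀ p q → χ (p ∧ q) ≡ ifNonZero (χ p) (χ q) 0
  χ-∧ true  q = refl
  χ-∧ false q = refl

  nextState-computable : Computable 2 (λ { (s ∷ y ∷ []) → nextState s y })
  nextState-computable = primRec (projection zero) (projection zero) _
                           (λ { (y ∷ []) → refl }) (λ { t (y ∷ []) → refl })

  nextSum-computable : Computable 3 (λ { (s ∷ p ∷ y ∷ []) → nextSum s p y })
  nextSum-computable =
    primRec (projection (suc zero))
      (compose₃ ifNonZero-computable (projection zero)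
        (compose₂ +-computable (projection (suc (suc zero))) (projection (suc (suc (suc zero)))))
        (projection (suc (suc zero))))
      _ (λ { (p ∷ y ∷ []) → refl }) (λ { t (p ∷ y ∷ []) → refl })

  state-computable : Computable 1 (λ { (y ∷ []) → state y })
  state-computable =
    primRec const₀
      (compose₃ ifNonZero-computable (compose₁ oracle (projection zero))
        (compose₂ nextState-computable (projection (suc zero)) (projection zero))
        (projection (suc zero)))
      _ (λ { [] → refl }) (λ { t [] → if⇒ifNonZero (H t) _ _ })

  partialSum-computable : Computable 1 (λ { (y ∷ []) → partialSum y })
  partialSum-computable =
    primRec const₀
      (compose₃ ifNonZero-computable (compose₁ oracle (projection zero))
        (compose₃ nextSum-computable (compose₁ state-computable (projection zero))
          (projection (suc zero)) (projection zero))
        (projection (suc zero)))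
      _ (λ { [] → refl }) (λ { t [] → if⇒ifNonZero (H t) _ _ })

  H₁-computable : Computes ⌜ H ⌝ ⌜ H₁ ⌝
  H₁-computable = computable⇒computes (computable-ext (λ { (x ∷ []) → sym (χ-∧ (state (suc x) ≡ᵇ 1) _) })
    (compose₃ ifNonZero-computable
      (compose₂ ≡ᵇ-computable (compose₁ state-computable successor) const₁)
      (compose₂ ≡ᵇ-computable (compose₁ partialSum-computable successor) (projection zero))
      const₀))

  H₂-computable : Computes ⌜ H ⌝ ⌜ H₂ ⌝
  H₂-computable = computable⇒computes (computable-ext (λ { (x ∷ []) → sym (χ-∧ (H x) _) })
    (compose₃ ifNonZero-computable oracle (compose₂ ≡ᵇ-computable state-computable const₁) const₀))

module Blocks (H : Set⊆ℕ) where

  open Window H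
  open BlockScan H

  Busy : ℕ → ℕ → Set
  Busy a y = ∀ h → h ∈ H → a < h → h < y → 2 ≤ state h

  Busy-suc : ∀ {a y} → Busy a y → (y ∈ H → 2 ≤ state y) → Busy a (suc y)
  Busy-suc busy new h h∈H a<h h<1+y with m≤n⇒m<n∨m≡n (s≤s⁻¹ h<1+y)
  ... | inj₁ h<y  = busy h h∈H a<h h<y
  ... | inj₂ refl = new h∈H

  -- The block read so far at position y, where the state is 1 + s.
  record OpenBlock (y s : ℕ) : Set where
    field
      start    : ℕ
      width    : ℕ
      ends     : start + suc width ≡ y
      start∈H  : start ∈ H
      opens    : state start ≡ 0
      awaiting : length (window start (suc width)) + s ≡ start
      sums     : sum (window start (suc width)) ≡ partialSum y
      busy     : Busy start y

  openBlock-new : ∀ {y s} → y ∈ H → state y ≡ 0 → suc s ≡ y → OpenBlock (suc y) s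
  openBlock-new {y} {s} y∈H st≡0 1+s≡y = record
    { start    = y
    ; width    = 0
    ; ends     = +-comm y 1
    ; start∈H  = y∈H
    ; opens    = st≡0
    ; awaiting = subst (λ w → length w + s ≡ y) (sym single) 1+s≡y
    ; sums     = begin
        sum (window y 1)                    ≡⟨ cong sum single ⟩
        y + 0                               ≡⟨ +-identityʳ y ⟩
        y                                   ≡⟨ cong (λ t → nextSum t (partialSum y) y) st≡0 ⟨
        nextSum (state y) (partialSum y) y  ≡⟨ partialSum-∈ y∈H ⟨
        partialSum (suc y)                  ∎
    ; busy     = λ h _ y<h h<1+y → ⊥-elim (<⇒≱ h<1+y y<h)
    }
    where
    open ≡-Reasoning
    single : window y 1 ≡ y ∷ []
    single = window-cons 0 y∈H

  openBlock-skip : ∀ {y s} → OpenBlock y s → H y ≡ false → OpenBlock (suc y) s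
  openBlock-skip {y} {s} b y∉H = record
    { start    = start
    ; width    = suc width
    ; ends     = trans (+-suc start (suc width)) (cong suc ends)
    ; start∈H  = start∈H
    ; opens    = opens
    ; awaiting = subst (λ w → length w + s ≡ start) (sym unchanged) awaiting
    ; sums     = trans (cong sum unchanged) (trans sums (sym (partialSum-∉ y∉H)))
    ; busy     = Busy-suc busy (λ y∈H → case trans (sym y∉H) y∈H of λ ())
    }
    where
    open OpenBlock b
    unchanged : window start (suc (suc width)) ≡ window start (suc width)
    unchanged = window-snoc-∉ (suc width) start ends y∉H

  openBlock-extend : ∀ {y s} → OpenBlock y (suc s) → y ∈ H → state y ≡ suc (suc s) → OpenBlock (suc y) s
  openBlock-extend {y} {s} b y∈H st≡2+s = record
    { start    = start
    ; width    = suc width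
    ; ends     = trans (+-suc start (suc width)) (cong suc ends)
    ; start∈H  = start∈H
    ; opens    = opens
    ; awaiting = begin
        length (window start (suc (suc width))) + s  ≡⟨ cong (λ w → length w + s) grown ⟩
        length (window start (suc width) ++ y ∷ []) + s
          ≡⟨ cong (_+ s) (length-++ (window start (suc width))) ⟩
        length (window start (suc width)) + 1 + s    ≡⟨ +-assoc (length (window start (suc width))) 1 s ⟩
        length (window start (suc width)) + suc s    ≡⟨ awaiting ⟩
        start                                        ∎
    ; sums     = begin
        sum (window start (suc (suc width)))         ≡⟨ cong sum grown ⟩
        sum (window start (suc width) ++ y ∷ [])     ≡⟨ sum-++ (window start (suc width)) (y ∷ []) ⟩
        sum (window start (suc width)) + (y + 0)     ≡⟨ cong₂ _+_ sums (+-identityʳ y) ⟩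
        partialSum y + y                             ≡⟨ cong (λ t → nextSum t (partialSum y) y) st≡2+s ⟨
        nextSum (state y) (partialSum y) y           ≡⟨ partialSum-∈ y∈H ⟨
        partialSum (suc y)                           ∎
    ; busy     = Busy-suc busy (λ _ → subst (2 ≤_) (sym st≡2+s) (s≤s (s≤s z≤n)))
    }
    where
    open OpenBlock b
    open ≡-Reasoning
    grown : window start (suc (suc width)) ≡ window start (suc width) ++ y ∷ []
    grown = window-snoc-∈ (suc width) start ends y∈H

  openBlock : ∀ y s → state y ≡ suc s → OpenBlock y s
  openBlock zero    s ()
  openBlock (suc y) s st≡1+s with H y in y∈H
  ... | false = openBlock-skip (openBlock y s st≡1+s) y∈H
  ... | true with state y in st-y
  ...   | zero         = openBlock-new y∈H st-y (sym st≡1+s)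
  ...   | suc zero     with () ← st≡1+s
  ...   | suc (suc s') with refl ← st≡1+s = openBlock-extend (openBlock y (suc s') st-y) y∈H st-y

  scan-const : ∀ k u → (∀ w → u ≤ w → w < u + k → H w ≡ false) →
               state (u + k) ≡ state u × partialSum (u + k) ≡ partialSum u
  scan-const zero    u _ rewrite +-identityʳ u = refl , refl
  scan-const (suc k) u gap rewrite +-suc u k
    with scan-const k u (λ w u≤w w<u+k → gap w u≤w (m<n⇒m<1+n w<u+k))
  ... | st≡ , ps≡ = trans (state-∉ u+k∉H) st≡ , trans (partialSum-∉ u+k∉H) ps≡
    where
    u+k∉H : H (u + k) ≡ false
    u+k∉H = gap (u + k) (m≤m+n u k) ≤-refl

  opening≤start : ∀ {a y s} → (b : OpenBlock y s) → a ∈ H → state a ≡ 0 → a < y → a ≤ OpenBlock.start b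
  opening≤start {a} b a∈H st≡0 a<y with a ≤? OpenBlock.start b
  ... | yes a≤start = a≤start
  ... | no  a≰start with () ← subst (2 ≤_) st≡0 (OpenBlock.busy b a a∈H (≰⇒> a≰start) a<y)

  start≤partialSum : ∀ {y s} (b : OpenBlock y s) → OpenBlock.start b ≤ partialSum y
  start≤partialSum b = subst (start ≤_) sums
    (≤-sum-window (suc width) start∈H ≤-refl (m<m+n start (s≤s z≤n)))
    where open OpenBlock b

  ∈H₁⇒ : ∀ {x} → x ∈ H₁ → state (suc x) ≡ 1 × partialSum (suc x) ≡ x
  ∈H₁⇒ {x} x∈H₁ with state (suc x) ≡ᵇ 1 in e₁ | partialSum (suc x) ≡ᵇ x in e₂
  ... | true | true = ≡ᵇ-true⇒≡ e₁ , ≡ᵇ-true⇒≡ e₂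

  ∈H₂⇒ : ∀ {x} → x ∈ H₂ → x ∈ H × state x ≡ 1
  ∈H₂⇒ {x} x∈H₂ with H x | state x ≡ᵇ 1 in e
  ... | true | true = refl , ≡ᵇ-true⇒≡ e

  ∈H₂ : ∀ {x} → x ∈ H → state x ≡ 1 → x ∈ H₂
  ∈H₂ x∈H st≡1 = cong₂ (λ h s → h ∧ (s ≡ᵇ 1)) x∈H st≡1

  H₁+H⊆FSω : ∀ {x₁ x₂} → x₁ ∈ H₁ → x₂ ∈ H → x₁ < x₂ → InFSω (x₁ + x₂) H
  H₁+H⊆FSω {x₁} {x₂} x₁∈H₁ x₂∈H x₁<x₂ =
    (a ∷ rest ++ x₂ ∷ []) , (linked , all∈H , size) , total
    where
    open OpenBlock (openBlock (suc x₁) 0 (proj₁ (∈H₁⇒ x₁∈H₁))) renaming (start to a; width to d)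
    open ≡-Reasoning
    rest : List ℕ
    rest = window (suc a) d
    cons : window a (suc d) ≡ a ∷ rest
    cons = window-cons d start∈H
    linked : Linked _<_ (a ∷ rest ++ x₂ ∷ [])
    linked = window-linked d (n<1+n a) (subst (_≤ x₂) (trans (sym ends) (+-suc a d)) x₁<x₂)
    all∈H : All (_∈ H) (a ∷ rest ++ x₂ ∷ [])
    all∈H = start∈H ∷ All.++⁺ (window⊆H d (suc a)) (x₂∈H ∷ [])
    size : length (a ∷ rest ++ x₂ ∷ []) ≡ a + 1
    size = begin
      suc (length (rest ++ x₂ ∷ []))  ≡⟨ cong suc (length-++ rest) ⟩
      suc (length rest + 1)           ≡⟨ cong (_+ 1) (+-identityʳ (suc (length rest))) ⟨
      suc (length rest) + 0 + 1       ≡⟨ cong (λ w → length w + 0 + 1) cons ⟨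
      length (window a (suc d)) + 0 + 1 ≡⟨ cong (_+ 1) awaiting ⟩
      a + 1                           ∎
    total : sum (a ∷ rest ++ x₂ ∷ []) ≡ x₁ + x₂
    total = begin
      a + sum (rest ++ x₂ ∷ [])       ≡⟨ cong (a +_) (sum-++ rest (x₂ ∷ [])) ⟩
      a + (sum rest + (x₂ + 0))       ≡⟨ +-assoc a (sum rest) (x₂ + 0) ⟨
      sum (a ∷ rest) + (x₂ + 0)       ≡⟨ cong₂ _+_ (trans (cong sum (sym cons)) sums) (+-identityʳ x₂) ⟩
      partialSum (suc x₁) + x₂        ≡⟨ cong (_+ x₂) (proj₂ (∈H₁⇒ x₁∈H₁)) ⟩
      x₁ + x₂                         ∎

module ApartBlocks (H : Set⊆ℕ) (H-positive : Positive H) (H-apart : Apart H) where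

  open BinaryExponents
  open Window H
  open BlockScan H
  open Blocks H
  open ApartWindowSums H H-positive H-apart

  -- The H₁-part of the block closed by b sums to x < b, and no element of H lies in (x, b).
  closing⇒partialSum∈H₁ : ∀ {b} → b ∈ H → state b ≡ 1 → partialSum b ∈ H₁
  closing⇒partialSum∈H₁ {b} b∈H st≡1 =
    trans (cong₂ (λ s p → (s ≡ᵇ 1) ∧ (p ≡ᵇ x)) state≡1 partialSum≡x) (≡ᵇ-refl x)
    where
    open OpenBlock (openBlock b 0 st≡1)
    x : ℕ
    x = partialSum b
    ≤x : ∀ {h} → h ∈ H → start ≤ h → h < b → h ≤ x
    ≤x {h} h∈H start≤h h<b =
      subst (h ≤_) sums (≤-sum-window (suc width) h∈H start≤h (subst (h <_) (sym ends) h<b))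
    x<b : x < b
    x<b with ∃IsLeastExp b (∈⇒>0 b∈H)
    ... | j , λb = subst (_< b) sums
      (<-≤-trans (sum-window<2^leastExp {b} {j} (suc width) start b∈H (≤-reflexive ends) λb)
                 (∣⇒≤ ⦃ >-nonZero (∈⇒>0 b∈H) ⦄ (proj₁ λb)))
    start≤x : start ≤ x
    start≤x = start≤partialSum (openBlock b 0 st≡1)
    gap : ∀ w → suc x ≤ w → w < suc x + (b ∸ suc x) → H w ≡ false
    gap w x<w w<b with H w in w∈H
    ... | false = refl
    ... | true  = ⊥-elim (<⇒≱ x<w (≤x w∈H (≤-trans start≤x (<⇒≤ x<w))
                                     (subst (w <_) (m+[n∸m]≡n x<b) w<b)))
    constant : state (suc x + (b ∸ suc x)) ≡ state (suc x) × partialSum (suc x + (b ∸ suc x)) ≡ partialSum (suc x)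
    constant = scan-const (b ∸ suc x) (suc x) gap
    state≡1 : state (suc x) ≡ 1
    state≡1 = trans (sym (proj₁ constant)) (trans (cong state (m+[n∸m]≡n x<b)) st≡1)
    partialSum≡x : partialSum (suc x) ≡ x
    partialSum≡x = trans (sym (proj₂ constant)) (cong partialSum (m+[n∸m]≡n x<b))

  -- x ∈ H₁ ∪ H₂ as the sum of a window of H: the first a elements of a block opened by a (for H₁),
  -- or a closing element alone (for H₂).
  record Block (x : ℕ) : Set where
    constructor block
    field
      start   : ℕ
      width   : ℕ
      start∈H : start ∈ H
      sums    : sum (window start (suc width)) ≡ x
      busy    : Busy start (start + suc width)
      kind    : (state start ≡ 0 × length (window start (suc width)) ≡ start) ⊎ (state start ≡ 1 × width ≡ 0)

  H₁⇒Block : ∀ {x} → x ∈ H₁ → Block x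
  H₁⇒Block {x} x∈H₁ with ∈H₁⇒ x∈H₁
  ... | st≡1 , ps≡x = block start width start∈H (trans sums ps≡x) (subst (Busy start) (sym ends) busy)
                            (inj₁ (opens , trans (sym (+-identityʳ _)) awaiting))
    where open OpenBlock (openBlock (suc x) 0 st≡1)

  H₂⇒Block : ∀ {x} → x ∈ H₂ → Block x
  H₂⇒Block {x} x∈H₂ with ∈H₂⇒ x∈H₂
  ... | x∈H , st≡1 = block x 0 x∈H (trans (cong sum (window-cons 0 x∈H)) (+-identityʳ x))
                       (λ h _ x<h h<x+1 → ⊥-elim (<⇒≱ (subst (h <_) (+-comm x 1) h<x+1) x<h))
                       (inj₂ (st≡1 , refl))

  H₁∪H₂⇒Block : ∀ {x} → x ∈ (H₁ ∪ H₂) → Block x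
  H₁∪H₂⇒Block {x} x∈H₁∪H₂ with H₁ x in x∈H₁
  ... | true  = H₁⇒Block x∈H₁
  ... | false = H₂⇒Block x∈H₁∪H₂

  start-state<2 : ∀ {x} (B : Block x) → state (Block.start B) < 2
  start-state<2 (block _ _ _ _ _ (inj₁ (st≡0 , _))) rewrite st≡0 = s≤s z≤n
  start-state<2 (block _ _ _ _ _ (inj₂ (st≡1 , _))) rewrite st≡1 = s≤s (s≤s z≤n)

  same-start⇒same-sum : ∀ {x x'} (B : Block x) (B' : Block x') → Block.start B ≡ Block.start B' → x ≡ x'
  same-start⇒same-sum (block l d _ sums _ (inj₁ (_ , len))) (block .l d' _ sums' _ (inj₁ (_ , len'))) refl =
    trans (sym sums) (trans equal sums')
    where
    equal : sum (window l (suc d)) ≡ sum (window l (suc d'))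
    equal with ≤-total (suc d) (suc d')
    ... | inj₁ d≤d' = length-window≡⇒sum-window≡ l d≤d' (trans len (sym len'))
    ... | inj₂ d'≤d = sym (length-window≡⇒sum-window≡ l d'≤d (trans len' (sym len)))
  same-start⇒same-sum (block l _ _ sums _ (inj₂ (_ , refl))) (block .l _ _ sums' _ (inj₂ (_ , refl))) refl =
    trans (sym sums) sums'
  same-start⇒same-sum (block l _ _ _ _ (inj₁ (st≡0 , _))) (block .l _ _ _ _ (inj₂ (st≡1 , _))) refl
    with () ← trans (sym st≡0) st≡1
  same-start⇒same-sum (block l _ _ _ _ (inj₂ (st≡1 , _))) (block .l _ _ _ _ (inj₁ (st≡0 , _))) refl
    with () ← trans (sym st≡0) st≡1

  -- A later block cannot start inside an earlier one, whose interior is busy; so the earlier sum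
  -- stays below 2 ^ λ l', which divides the later sum.
  start<start⇒apart : ∀ {x x'} (B : Block x) (B' : Block x') → Block.start B < Block.start B' →
                      x < x' × (∀ i j → IsGreatestExp x i → IsLeastExp x' j → i < j)
  start<start⇒apart {x} {x'} B@(block l d _ sums busy _) B'@(block l' d' l'∈H sums' _ _) l<l' with l' <? l + suc d
  ... | yes inside  = ⊥-elim (<⇒≱ (start-state<2 B') (busy l' l'∈H l<l' inside))
  ... | no  outside with ∃IsLeastExp l' (∈⇒>0 l'∈H)
  ... | j' , λl' = x<x' , μx<λx'
    where
    x<2^j' : x < 2 ^ j'
    x<2^j' = subst (_< 2 ^ j') sums (sum-window<2^leastExp {l'} {j'} (suc d) l l'∈H (≮⇒≥ outside) λl')
    x<x' : x < x'
    x<x' = <-≤-trans x<2^j'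
             (≤-trans (∣⇒≤ ⦃ >-nonZero (∈⇒>0 l'∈H) ⦄ (proj₁ λl'))
                      (subst (l' ≤_) sums' (≤-sum-window (suc d') l'∈H ≤-refl (m<m+n l' (s≤s z≤n)))))
    2^j'∣x' : 2 ^ j' ∣ x'
    2^j'∣x' = subst (2 ^ j' ∣_) sums' (2^leastExp∣sum-window {l'} {j'} (suc d') l'∈H λl')
    μx<λx' : ∀ i j → IsGreatestExp x i → IsLeastExp x' j → i < j
    μx<λx' i j μx λx' = <-≤-trans (2^-cancel-< {i} {j'} (≤-<-trans (proj₁ μx) x<2^j'))
                                   (2^∣⇒≤leastExp {e = j'} 2^j'∣x' λx')

  H₁∪H₂-apart : Apart (H₁ ∪ H₂)
  H₁∪H₂-apart x x' x∈ x'∈ x<x' with H₁∪H₂⇒Block x∈ | H₁∪H₂⇒Block x'∈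
  ... | B | B' with <-cmp (Block.start B) (Block.start B')
  ... | tri< l<l' _ _ = proj₂ (start<start⇒apart B B' l<l')
  ... | tri≈ _ l≡l' _ = ⊥-elim (<-irrefl (same-start⇒same-sum B B' l≡l') x<x')
  ... | tri> _ _ l'<l = ⊥-elim (<-asym x<x' (proj₁ (start<start⇒apart B' B l'<l)))

module Unbounded (H : Set⊆ℕ) (H-positive : Positive H) (H-apart : Apart H) (H-infinite : Infinite H) where

  open BlockScan H
  open Blocks H
  open ApartBlocks H H-positive H-apart

  next∈H : ∀ y → ∃ λ z → y ≤ z × z ∈ H × state z ≡ state y
  next∈H y with H-infinite y
  ... | m , y<m , m∈H = first (m ∸ y) y (subst (_∈ H) (sym (m+[n∸m]≡n (<⇒≤ y<m))) m∈H)
    where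
    first : ∀ k y → (y + k) ∈ H → ∃ λ z → y ≤ z × z ∈ H × state z ≡ state y
    first k y y+k∈H with H y in y∈H
    ... | true = y , ≤-refl , y∈H , refl
    first zero y y+0∈H | false with () ← trans (sym y∈H) (subst (_∈ H) (+-identityʳ y) y+0∈H)
    first (suc k) y y+k∈H | false with first k (suc y) (subst (_∈ H) (+-suc y k) y+k∈H)
    ... | z , y<z , z∈H , st≡ = z , <⇒≤ y<z , z∈H , trans st≡ (state-∉ y∈H)

  -- From a state above t, every further element of H lowers the state by one until it reaches t.
  reach-state : ∀ t s y → state y ≡ t + s → ∃ λ z → y ≤ z × z ∈ H × state z ≡ t
  reach-state t zero y st≡t+0 with next∈H y
  ... | z , y≤z , z∈H , st≡ = z , y≤z , z∈H , trans st≡ (trans st≡t+0 (+-identityʳ t))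
  reach-state t (suc s) y st≡t+1+s with next∈H y
  ... | z , y≤z , z∈H , st≡
    with reach-state t s (suc z)
           (trans (state-∈ z∈H) (cong (λ r → nextState r z) (trans st≡ (trans st≡t+1+s (+-suc t s)))))
  ... | w , z<w , w∈H , st≡t = w , ≤-trans y≤z (<⇒≤ z<w) , w∈H , st≡t

  block-after : ∀ n → ∃ λ a → ∃ λ b → n < a × a < b × a ∈ H × state a ≡ 0 × b ∈ H × state b ≡ 1
  block-after n with reach-state 0 (state (suc n)) (suc n) refl
  ... | a@(suc a₀) , n<a , a∈H , st-a≡0
    with reach-state 1 a₀ (suc a) (trans (state-∈ a∈H) (cong (λ r → nextState r a) st-a≡0))
  ... | b , a<b , b∈H , st-b≡1 = a , b , n<a , a<b , a∈H , st-a≡0 , b∈H , st-b≡1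

  H₁-infinite : Infinite H₁
  H₁-infinite n with block-after n
  ... | a , b , n<a , a<b , a∈H , st-a≡0 , b∈H , st-b≡1 =
    partialSum b ,
    <-≤-trans n<a (≤-trans (opening≤start closing a∈H st-a≡0 a<b) (start≤partialSum closing)) ,
    closing⇒partialSum∈H₁ b∈H st-b≡1
    where
    closing : OpenBlock b 0
    closing = openBlock b 0 st-b≡1

  H₂-infinite : Infinite H₂
  H₂-infinite n with block-after n
  ... | a , b , n<a , a<b , _ , _ , b∈H , st-b≡1 = b , <-trans n<a a<b , ∈H₂ b∈H st-b≡1

HTSol⇒IPHTSol : ∀ f H → HTSol f H →
  ∃ λ H₁ → ∃ λ H₂ → Computes ⌜ H ⌝ ⌜ H₁ ⌝ × Computes ⌜ H ⌝ ⌜ H₂ ⌝ × IPHTSol f H₁ H₂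
HTSol⇒IPHTSol f H (H-positive , H-infinite , H-apart , k , FSω-monochromatic) =
  H₁ , H₂ , H₁-computable , H₂-computable ,
  H₁-positive H-positive , H₂-positive H-positive , H₁-infinite , H₂-infinite , H₁∪H₂-apart ,
  k , λ x₁ x₂ x₁∈H₁ x₂∈H₂ x₁<x₂ →
        FSω-monochromatic (x₁ + x₂) (H₁+H⊆FSω x₁∈H₁ (proj₁ (∈H₂⇒ x₂∈H₂)) x₁<x₂)
  where
  open BlockScan H
  open Blocks H
  open ApartBlocks H H-positive H-apart
  open Unbounded H H-positive H-apart H-infinite

proposition6 : (f : ℕ → Bool) →
    Σ (ℕ → Bool) λ J → Computes ⌜ f ⌝ ⌜ J ⌝ ×
      ((H : ℕ → Bool) → HTSol J H →
        ∃ λ (H₁ : ℕ → Bool) → ∃ λ (H₂ : ℕ → Bool) →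
          Computes ⌜ H ⌝ ⌜ H₁ ⌝ × Computes ⌜ H ⌝ ⌜ H₂ ⌝ × IPHTSol f H₁ H₂)
proposition6 f = f , (orc , λ _ → e-orc) , HTSol⇒IPHTSol f
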